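{- Let $G$ be a $2$-tree. Then there is a book embedding of $G$ together with a partition of $E(G)$ into 2 classes (colours), each class forming a forest no two of whose edges cross, such that: if $G\cong K_3$ then two vertices are colourful, and if $G\not\cong K_3$ then every $2$-simplicial vertex of $G$ is colourful.
   Context: Graphs are finite and simple. A vertex is $2$-simplicial if its neighbourhood is a clique of size 2. A $2$-tree: $K_3$ is a $2$-tree, and if $G$ has a $2$-simplicial vertex $v$ and $G-v$ is a $2$-tree then $G$ is a $2$-tree. A book embedding places the vertices injectively at points in convex position in the plane and draws edges as straight segments; two edges cross if they intersect at a point other than a common endpoint. Given a partition of the edges into colour classes, a vertex is colourful if all edges incident to it receive distinct colours. -}

module Defs where

open import Data.Nat as ℕ using (ℕ; zero; suc; _≤_; _<_)
open import Data.Bool using (Bool; true; false; not)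
open import Data.Fin using (Fin; zero; suc; toℕ; punchIn; inject₁; fromℕ; _≟_)
open import Data.Fin.Properties using (punchIn-injective)
open import Data.Product using (Σ; _×_; _,_; ∃)
open import Data.Sum using (_⊎_)
open import Relation.Nullary using (¬_; yes; no)
open import Relation.Binary.PropositionalEquality using (_≡_; _≢_; refl)
open import Function.Bundles using (_↔_; Inverse)
open import Function.Definitions using (Injective)

record Graph (n : ℕ) : Set where
  field
    adj     : Fin n → Fin n → Bool
    sym     : ∀ i j → adj i j ≡ adj j i
    irrefl  : ∀ i → adj i i ≡ false
open Graph public

Adj : ∀ {n} → Graph n → Fin n → Fin n → Set
Adj G i j = adj G i j ≡ true

delete : ∀ {n} → Graph (suc n) → Fin (suc n) → Graph n
delete G v = record
  { adj    = λ i j → adj G (punchIn v i) (punchIn v j)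
  ; sym    = λ i j → sym G (punchIn v i) (punchIn v j)
  ; irrefl = λ i → irrefl G (punchIn v i)
  }

TwoSimplicial : ∀ {n} → Graph n → Fin n → Set
TwoSimplicial G v =
  Σ _ λ a → Σ _ λ b → a ≢ b × Adj G v a × Adj G v b × Adj G a b ×
    (∀ u → Adj G v u → u ≡ a ⊎ u ≡ b)

IsComplete : ∀ {n} → Graph n → Set
IsComplete G = ∀ i j → i ≢ j → Adj G i j

data IsTwoTree : ∀ {n} → Graph n → Set where
  triangle : (G : Graph 3) → IsComplete G → IsTwoTree G
  extend   : ∀ {n} (G : Graph (suc n)) (v : Fin (suc n)) →
             TwoSimplicial G v → IsTwoTree (delete G v) → IsTwoTree G

K3 : Graph 3
K3 = record { adj = a ; sym = s ; irrefl = r }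
  where
  a : Fin 3 → Fin 3 → Bool
  a i j with i ≟ j
  ... | yes _ = false
  ... | no  _ = true
  s : ∀ i j → a i j ≡ a j i
  s zero zero = refl
  s zero (suc zero) = refl
  s zero (suc (suc zero)) = refl
  s (suc zero) zero = refl
  s (suc zero) (suc zero) = refl
  s (suc zero) (suc (suc zero)) = refl
  s (suc (suc zero)) zero = refl
  s (suc (suc zero)) (suc zero) = refl
  s (suc (suc zero)) (suc (suc zero)) = refl
  r : ∀ i → a i i ≡ false
  r zero = refl
  r (suc zero) = refl
  r (suc (suc zero)) = refl

_≅_ : ∀ {n m} → Graph n → Graph m → Set
_≅_ {n} {m} G H = Σ (Fin n ↔ Fin m) λ φ →
  ∀ i j → adj G i j ≡ adj H (Inverse.to φ i) (Inverse.to φ j)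

-- Book embedding: vertices placed injectively on points in convex position,
-- recorded by their (cyclic) position index pos : Fin n → Fin n.
-- Straight chords ab and cd (in convex position) cross iff their endpoints
-- interleave; quantifying over all orderings of endpoints, this is:
Cross : ∀ {n} → (Fin n → Fin n) → Fin n → Fin n → Fin n → Fin n → Set
Cross pos a b c d =
  toℕ (pos a) < toℕ (pos c) × toℕ (pos c) < toℕ (pos b) × toℕ (pos b) < toℕ (pos d)

Colouring : ℕ → Set
Colouring n = Fin n → Fin n → Fin 2

AdjC : ∀ {n} → Graph n → Colouring n → Fin 2 → Fin n → Fin n → Set
AdjC G col c i j = Adj G i j × col i j ≡ c

Cycle : ∀ {n} → Graph n → Colouring n → Fin 2 → Set
Cycle {n} G col c =
  Σ ℕ λ k → 2 ≤ k × Σ (Fin (suc k) → Fin n) λ f →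
    Injective _≡_ _≡_ f ×
    (∀ (i : Fin k) → AdjC G col c (f (inject₁ i)) (f (suc i))) ×
    AdjC G col c (f (fromℕ k)) (f zero)

ClassForest : ∀ {n} → Graph n → Colouring n → Fin 2 → Set
ClassForest G col c = ¬ Cycle G col c

ClassNonCrossing : ∀ {n} → Graph n → (Fin n → Fin n) → Colouring n → Fin 2 → Set
ClassNonCrossing G pos col c =
  ∀ a b x y → AdjC G col c a b → AdjC G col c x y → ¬ Cross pos a b x y

Colourful : ∀ {n} → Graph n → Colouring n → Fin n → Set
Colourful G col v =
  ∀ u w → u ≢ w → Adj G v u → Adj G v w → col v u ≢ col v w

{-# OPTIONS --safe #-}
module Submission where

-- The vertices are placed along the order in which the 2-tree is built. Left-coloured edges are read
-- as pointing leftwards and right-coloured ones rightwards: if every vertex has at most one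
-- left-coloured edge to its left (and dually), there is no monochromatic cycle, as the extreme vertex
-- of one would have two. A new 2-simplicial vertex v on the edge lr, l left of r, gets a left edge
-- to l and a right edge to r, so v is colourful. It is put immediately before r if lr is
-- left-coloured and immediately after l otherwise: then the edge from v to the near end of lr
-- crosses nothing, and an edge of the same colour crossing the other one would cross lr or reach the
-- corresponding end of lr from under the arc, which the invariant `Layout` rules out. Attaching v
-- makes l and r non-2-simplicial and changes no other neighbourhood or colour. In the base triangle
-- one vertex has both edges left-coloured; it is chosen to be an end of the edge that the next
-- vertex is attached to.

open import Defs hiding (sym)
open import Data.Nat as ℕ using (zero; suc; z≤n; s≤s)
import Data.Nat.Properties as ℕ
open import Data.Bool using (true)
open import Data.Bool.Properties using () renaming (_≟_ to _≟ᵇ_)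
open import Data.Fin
  using (Fin; zero; suc; toℕ; punchIn; punchOut; inject₁; fromℕ; opposite; _≟_; _<_; _≤_)
open import Data.Fin.Properties
  using (punchIn-injective; punchInᵢ≢i; punchIn-punchOut; punchIn-mono-≤; toℕ-injective; toℕ-inject₁;
         toℕ-fromℕ; toℕ<n; opposite-involutive; <-trans; <-asym; <-irrefl; <-cmp)
open import Data.Fin.Relation.Unary.Top using (view; ‵fromℕ; ‵inject₁)
open import Data.Fin.Permutation using (↔⇒≡)
open import Data.Vec.Functional using (insertAt)
open import Data.Vec.Functional.Properties using (insertAt-lookup; insertAt-punchIn)
open import Data.Product using (Σ; ∃; ∃₂; _×_; _,_; proj₁; proj₂)
open import Data.Sum using (_⊎_; inj₁; inj₂; [_,_]′) renaming (map to ⊎-map; swap to ⊎-swap)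
open import Data.Empty using (⊥; ⊥-elim)
open import Relation.Nullary using (¬_; Dec; yes; no)
open import Relation.Binary using (Rel; Transitive; Trichotomous; tri<; tri≈; tri>)
import Relation.Binary.Construct.Flip.EqAndOrd as Flip
open import Relation.Binary.PropositionalEquality
  using (_≡_; _≢_; refl; sym; trans; cong; cong-app; subst; subst₂)
open import Function.Base using (_∘_; id)
open import Function.Definitions using (Injective)
open import Function.Construct.Identity using (↔-id)

left right : Fin 2
left  = zero
right = suc zero

left≢right : left ≢ right
left≢right ()

Adj? : ∀ {n} (G : Graph n) x y → Dec (Adj G x y)
Adj? G x y = adj G x y ≟ᵇ true

Adj-sym : ∀ {n} (G : Graph n) {x y} → Adj G x y → Adj G y x
Adj-sym G {x} {y} = trans (Graph.sym G y x)

Adj-irrefl : ∀ {n} (G : Graph n) x → ¬ Adj G x x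
Adj-irrefl G x e with trans (sym e) (irrefl G x)
... | ()

Adj⇒≢ : ∀ {n} (G : Graph n) {x y} → Adj G x y → x ≢ y
Adj⇒≢ G {x} e refl = Adj-irrefl G x e

AdjC-sym : ∀ {n} (G : Graph n) {col : Colouring n} → (∀ i j → Adj G i j → col i j ≡ col j i) →
           ∀ {c x y} → AdjC G col c x y → AdjC G col c y x
AdjC-sym G col-sym {x = x} {y} (e , c) = Adj-sym G e , trans (sym (col-sym x y e)) c

data PunchInView {n} (v : Fin (suc n)) : Fin (suc n) → Set where
  ‵pivot   : PunchInView v v
  ‵punchIn : (i : Fin n) → PunchInView v (punchIn v i)

punchInView : ∀ {n} (v x : Fin (suc n)) → PunchInView v x
punchInView v x with v ≟ x
... | yes refl = ‵pivot
... | no  v≢x  = subst (PunchInView v) (punchIn-punchOut v≢x) (‵punchIn (punchOut v≢x))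

punchIn-cancel-< : ∀ {n} (i : Fin (suc n)) {j k : Fin n} → punchIn i j < punchIn i k → j < k
punchIn-cancel-< i {j} {k} p = ℕ.≰⇒> (λ k≤j → ℕ.<⇒≱ p (punchIn-mono-≤ i k j k≤j))

punchIn<⇒< : ∀ {n} (i : Fin (suc n)) (j : Fin n) → punchIn i j < i → toℕ j ℕ.< toℕ i
punchIn<⇒< (suc i) zero    _       = ℕ.z<s
punchIn<⇒< (suc i) (suc j) (s≤s p) = s≤s (punchIn<⇒< i j p)

<punchIn⇒≤ : ∀ {n} (i : Fin (suc n)) (j : Fin n) → i < punchIn i j → toℕ i ℕ.≤ toℕ j
<punchIn⇒≤ zero    j       _       = z≤n
<punchIn⇒≤ (suc i) (suc j) (s≤s p) = s≤s (<punchIn⇒≤ i j p)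

<⇒punchIn< : ∀ {n} (i : Fin (suc n)) (j : Fin n) → toℕ j ℕ.< toℕ i → punchIn i j < i
<⇒punchIn< (suc i) zero    _       = ℕ.z<s
<⇒punchIn< (suc i) (suc j) (s≤s p) = s≤s (<⇒punchIn< i j p)

≤⇒<punchIn : ∀ {n} (i : Fin (suc n)) (j : Fin n) → toℕ i ℕ.≤ toℕ j → i < punchIn i j
≤⇒<punchIn zero    j       _       = ℕ.z<s
≤⇒<punchIn (suc i) (suc j) (s≤s p) = s≤s (≤⇒<punchIn i j p)

maximum : ∀ {a ℓ} {A : Set a} {_≺_ : Rel A ℓ} → Transitive _≺_ → Trichotomous _≡_ _≺_ →
          ∀ k (f : Fin (suc k) → A) → ∃ λ m → ∀ j → f j ≡ f m ⊎ f j ≺ f m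
maximum ≺-trans compare zero    f = zero , λ { zero → inj₁ refl }
maximum {_≺_ = _≺_} ≺-trans compare (suc k) f with maximum ≺-trans compare k (f ∘ suc)
... | m , below with compare (f zero) (f (suc m))
...   | tri< f₀≺fm _ _ = suc m , λ { zero → inj₂ f₀≺fm ; (suc j) → below j }
...   | tri≈ _ f₀≡fm _ = suc m , λ { zero → inj₁ f₀≡fm ; (suc j) → below j }
...   | tri> _ _ fm≺f₀ = zero , λ { zero → inj₁ refl ; (suc j) → inj₂ (below-f₀ (below j)) }
  where
  below-f₀ : ∀ {x} → x ≡ f (suc m) ⊎ x ≺ f (suc m) → x ≺ f zero
  below-f₀ (inj₁ refl) = fm≺f₀
  below-f₀ (inj₂ x≺fm) = ≺-trans x≺fm fm≺f₀

module _ {n} (G : Graph n) (col : Colouring n) {c : Fin 2} {k} {f : Fin (suc k) → Fin n}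
  (step : ∀ (i : Fin k) → AdjC G col c (f (inject₁ i)) (f (suc i)))
  (wrap : AdjC G col c (f (fromℕ k)) (f zero)) where

  cycle-successor : ∀ m → ∃ λ m₊ → AdjC G col c (f m) (f m₊) ×
                    (toℕ m₊ ≡ suc (toℕ m) ⊎ toℕ m ≡ k × toℕ m₊ ≡ 0)
  cycle-successor m with view m
  ... | ‵fromℕ     = zero , wrap , inj₂ (toℕ-fromℕ k , refl)
  ... | ‵inject₁ i = suc i , step i , inj₁ (cong suc (sym (toℕ-inject₁ i)))

  cycle-predecessor : ∀ m → ∃ λ m₋ → AdjC G col c (f m₋) (f m) ×
                      (toℕ m ≡ suc (toℕ m₋) ⊎ toℕ m ≡ 0 × toℕ m₋ ≡ k)
  cycle-predecessor zero    = fromℕ k , wrap , inj₂ (refl , toℕ-fromℕ k)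
  cycle-predecessor (suc j) = inject₁ j , step j , inj₁ (cong suc (sym (toℕ-inject₁ j)))

cycle-neighbours-distinct : ∀ {k t t₊ t₋} → 2 ℕ.≤ k →
  t₊ ≡ suc t ⊎ t ≡ k × t₊ ≡ 0 → t ≡ suc t₋ ⊎ t ≡ 0 × t₋ ≡ k → t₊ ≢ t₋
cycle-neighbours-distinct _             (inj₁ refl)         (inj₁ refl)         =
  λ e → ℕ.<-irrefl (sym e) (ℕ.m<n⇒m<1+n (ℕ.n<1+n _))
cycle-neighbours-distinct (s≤s (s≤s _)) (inj₁ refl)         (inj₂ (refl , refl)) = λ ()
cycle-neighbours-distinct (s≤s (s≤s _)) (inj₂ (refl , refl)) (inj₁ refl)         = λ ()
cycle-neighbours-distinct (s≤s (s≤s _)) (inj₂ (refl , refl)) (inj₂ (() , _))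

lower-neighbour-unique⇒forest :
  ∀ {n ℓ} (G : Graph n) {col : Colouring n} {c} (_≺_ : Rel (Fin n) ℓ) →
  Transitive _≺_ → Trichotomous _≡_ _≺_ → (∀ i j → Adj G i j → col i j ≡ col j i) →
  (∀ x y z → AdjC G col c x y → AdjC G col c x z → y ≺ x → z ≺ x → y ≡ z) →
  ClassForest G col c
lower-neighbour-unique⇒forest G {col} {c} _≺_ ≺-trans compare col-sym lower-unique
  (k , 2≤k , f , f-inj , step , wrap) with maximum ≺-trans compare k f
... | m , f≼fm with cycle-successor G col step wrap m | cycle-predecessor G col step wrap m
... | m₊ , e₊ , t₊ | m₋ , e₋ , t₋ =
  cycle-neighbours-distinct 2≤k t₊ t₋
    (cong toℕ (f-inj (lower-unique _ _ _ e₊ e₋˘ (below e₊) (below e₋˘))))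
  where
  e₋˘ : AdjC G col c (f m) (f m₋)
  e₋˘ = AdjC-sym G col-sym e₋

  below : ∀ {j} → AdjC G col c (f m) (f j) → f j ≺ f m
  below {j} e with f≼fm j
  ... | inj₁ fj≡fm = ⊥-elim (Adj⇒≢ G (proj₁ e) (sym fj≡fm))
  ... | inj₂ fj≺fm = fj≺fm

record Layout {n} (G : Graph n) : Set where
  field
    pos                 : Fin n → Fin n
    col                 : Colouring n
    pos-injective       : Injective _≡_ _≡_ pos
    col-sym             : ∀ i j → Adj G i j → col i j ≡ col j i
    nonCrossing         : ∀ c → ClassNonCrossing G pos col c
    left-parent-unique  : ∀ x y z → AdjC G col left x y → AdjC G col left x z →
                          pos y < pos x → pos z < pos x → y ≡ z
    right-parent-unique : ∀ x y z → AdjC G col right x y → AdjC G col right x z →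
                          pos x < pos y → pos x < pos z → y ≡ z
    under-left-arc      : ∀ l r x → AdjC G col left l r → pos l < pos r →
                          Adj G x r → pos l < pos x → pos x < pos r → col x r ≡ right
    under-right-arc     : ∀ l r x → AdjC G col right l r → pos l < pos r →
                          Adj G l x → pos l < pos x → pos x < pos r → col l x ≡ left

module LayoutProperties {n} {G : Graph n} (L : Layout G) where
  open Layout L

  pos-≤⇒<⊎≡ : ∀ {x y} → pos x ≤ pos y → pos x < pos y ⊎ x ≡ y
  pos-≤⇒<⊎≡ p = ⊎-map id (pos-injective ∘ toℕ-injective) (ℕ.m≤n⇒m<n∨m≡n p)

  _≺_ : Rel (Fin n) _
  x ≺ y = pos x < pos y

  pos-compare : Trichotomous _≡_ _≺_
  pos-compare x y with <-cmp (pos x) (pos y)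
  ... | tri< p q r = tri< p (q ∘ cong pos) r
  ... | tri≈ p q r = tri≈ p (pos-injective q) r
  ... | tri> p q r = tri> p (q ∘ cong pos) r

  edge-sym : ∀ {c x y} → AdjC G col c x y → AdjC G col c y x
  edge-sym = AdjC-sym G col-sym

  forest : ∀ c → ClassForest G col c
  forest zero       =
    lower-neighbour-unique⇒forest G _≺_ <-trans pos-compare col-sym left-parent-unique
  forest (suc zero) =
    lower-neighbour-unique⇒forest G (λ x y → y ≺ x) (Flip.trans _≺_ <-trans) (Flip.compare _≺_ pos-compare)
      col-sym right-parent-unique

  left-arc-shields : ∀ {l r x y} → AdjC G col left l r → pos l < pos r → pos l < pos x → pos x < pos r →
                     AdjC G col left x y → pos y < pos l ⊎ pos r ≤ pos y → ⊥
  left-arc-shields lr l<r l<x x<r xy (inj₁ y<l) =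
    nonCrossing left _ _ _ _ (edge-sym xy) lr (y<l , l<x , x<r)
  left-arc-shields lr l<r l<x x<r xy (inj₂ r≤y) with pos-≤⇒<⊎≡ r≤y
  ... | inj₁ r<y  = nonCrossing left _ _ _ _ lr xy (l<x , x<r , r<y)
  ... | inj₂ refl = left≢right (trans (sym (proj₂ xy)) (under-left-arc _ _ _ lr l<r (proj₁ xy) l<x x<r))

  right-arc-shields : ∀ {l r x y} → AdjC G col right l r → pos l < pos r → pos l < pos x →
                      pos x < pos r → AdjC G col right x y → pos y ≤ pos l ⊎ pos r < pos y → ⊥
  right-arc-shields lr l<r l<x x<r xy (inj₂ r<y) = nonCrossing right _ _ _ _ lr xy (l<x , x<r , r<y)
  right-arc-shields {l} {x = x} lr l<r l<x x<r xy (inj₁ y≤l) with pos-≤⇒<⊎≡ y≤l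
  ... | inj₁ y<l  = nonCrossing right _ _ _ _ (edge-sym xy) lr (y<l , l<x , x<r)
  ... | inj₂ refl = left≢right (trans (sym (under-right-arc _ _ _ lr l<r (proj₁ lx) l<x x<r)) (proj₂ lx))
    where
    lx : AdjC G col right l x
    lx = edge-sym xy

colourful-of-two-neighbours : ∀ {n} {G : Graph n} {col : Colouring n} {x a b} →
  (∀ u → Adj G x u → u ≡ a ⊎ u ≡ b) → col x a ≢ col x b → Colourful G col x
colourful-of-two-neighbours nbhd ca≢cb u w u≢w xu xw cu≡cw with nbhd u xu | nbhd w xw
... | inj₁ refl | inj₁ refl = u≢w refl
... | inj₁ refl | inj₂ refl = ca≢cb cu≡cw
... | inj₂ refl | inj₁ refl = ca≢cb (sym cu≡cw)
... | inj₂ refl | inj₂ refl = u≢w refl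

ColourfulExcept : ∀ {n} → Graph n → Colouring n → Fin n → Set
ColourfulExcept G col z = ∀ w → w ≢ z → TwoSimplicial G w → Colourful G col w

AllColourful : ∀ {n} → Graph n → Colouring n → Set
AllColourful G col = ∀ w → TwoSimplicial G w → Colourful G col w

TwoNeighbours : ∀ {n} → Graph n → Fin n → Set
TwoNeighbours G x = ∃₂ λ y z → y ≢ z × Adj G x y × Adj G x z

three-neighbours⇒¬twoSimplicial : ∀ {n} (G : Graph n) {x p q s} → p ≢ q → p ≢ s → q ≢ s →
  Adj G x p → Adj G x q → Adj G x s → ¬ TwoSimplicial G x
three-neighbours⇒¬twoSimplicial G {p = p} {q} {s} p≢q p≢s q≢s xp xq xs
  (a , b , _ , _ , _ , _ , nbhd) = pigeonhole (nbhd p xp) (nbhd q xq) (nbhd s xs)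
  where
  pigeonhole : p ≡ a ⊎ p ≡ b → q ≡ a ⊎ q ≡ b → s ≡ a ⊎ s ≡ b → ⊥
  pigeonhole (inj₁ p≡a) (inj₁ q≡a) _          = p≢q (trans p≡a (sym q≡a))
  pigeonhole (inj₂ p≡b) (inj₂ q≡b) _          = p≢q (trans p≡b (sym q≡b))
  pigeonhole (inj₁ p≡a) (inj₂ _)   (inj₁ s≡a) = p≢s (trans p≡a (sym s≡a))
  pigeonhole (inj₂ p≡b) (inj₁ _)   (inj₂ s≡b) = p≢s (trans p≡b (sym s≡b))
  pigeonhole (inj₁ _)   (inj₂ q≡b) (inj₂ s≡b) = q≢s (trans q≡b (sym s≡b))
  pigeonhole (inj₂ _)   (inj₁ q≡a) (inj₁ s≡a) = q≢s (trans q≡a (sym s≡a))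

module _ {n} (G : Graph (suc n)) (v : Fin (suc n)) {i : Fin n} (v≁i : ¬ Adj G v (punchIn v i)) where

  twoSimplicial-delete : TwoSimplicial G (punchIn v i) → TwoSimplicial (delete G v) i
  twoSimplicial-delete (a , b , a≢b , ia , ib , ab , nbhd) with punchInView v a | punchInView v b
  ... | ‵pivot      | _           = ⊥-elim (v≁i (Adj-sym G ia))
  ... | ‵punchIn _  | ‵pivot      = ⊥-elim (v≁i (Adj-sym G ib))
  ... | ‵punchIn a′ | ‵punchIn b′ = a′ , b′ , a≢b ∘ cong (punchIn v) , ia , ib , ab ,
    λ u iu → ⊎-map (punchIn-injective v u a′) (punchIn-injective v u b′) (nbhd (punchIn v u) iu)

  colourful-lift : {col : Colouring (suc n)} {col′ : Colouring n} →
    (∀ j → col (punchIn v i) (punchIn v j) ≡ col′ i j) →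
    Colourful (delete G v) col′ i → Colourful G col (punchIn v i)
  colourful-lift col≡ colourful′ u w u≢w iu iw cu≡cw with punchInView v u | punchInView v w
  ... | ‵pivot     | _          = v≁i (Adj-sym G iu)
  ... | ‵punchIn _ | ‵pivot     = v≁i (Adj-sym G iw)
  ... | ‵punchIn j | ‵punchIn k =
    colourful′ j k (u≢w ∘ cong (punchIn v)) iu iw (trans (sym (col≡ j)) (trans cu≡cw (col≡ k)))

module Extension {n} (G : Graph (suc n)) (v : Fin (suc n)) (L′ : Layout (delete G v))
  (l r : Fin n) (l-r : Adj (delete G v) l r) (l<r : Layout.pos L′ l < Layout.pos L′ r)
  (v-nbhd : ∀ u → Adj G v u → u ≡ punchIn v l ⊎ u ≡ punchIn v r) where

  open Layout L′ using ()
    renaming (pos to pos′; col to col′; pos-injective to pos′-injective; col-sym to col′-sym;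
              nonCrossing to nonCrossing′; left-parent-unique to left-parent-unique′;
              right-parent-unique to right-parent-unique′; under-left-arc to under-left-arc′;
              under-right-arc to under-right-arc′)
  open LayoutProperties L′ using (left-arc-shields; right-arc-shields)

  ι : Fin n → Fin (suc n)
  ι = punchIn v

  -- s is the position of v; the old vertices are punched in around it.
  data Placement (s : Fin (suc n)) : Set where
    before-r : col′ l r ≡ left  → toℕ s ≡ toℕ (pos′ r)       → Placement s
    after-l  : col′ l r ≡ right → toℕ s ≡ suc (toℕ (pos′ l)) → Placement s

  placement : Σ (Fin (suc n)) Placement
  placement with col′ l r in lr-col
  ... | zero     = inject₁ (pos′ r) , before-r lr-col (toℕ-inject₁ (pos′ r))
  ... | suc zero = suc (pos′ l) , after-l lr-col refl

  slot : Fin (suc n)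
  slot = proj₁ placement

  placed : Placement slot
  placed = proj₂ placement

  col-at-v : Fin n → Fin 2
  col-at-v i with i ≟ l
  ... | yes _ = left
  ... | no  _ = right

  pos : Fin (suc n) → Fin (suc n)
  pos = insertAt (λ i → punchIn slot (pos′ i)) v slot

  col : Colouring (suc n)
  col = insertAt (λ i → insertAt (col′ i) v (col-at-v i)) v (insertAt col-at-v v left)

  pos-v : pos v ≡ slot
  pos-v = insertAt-lookup _ v slot

  pos-ι : ∀ i → pos (ι i) ≡ punchIn slot (pos′ i)
  pos-ι = insertAt-punchIn _ v slot

  col-ιι : ∀ i j → col (ι i) (ι j) ≡ col′ i j
  col-ιι i j = trans (cong-app (insertAt-punchIn _ v _ i) (ι j)) (insertAt-punchIn (col′ i) v _ j)

  col-vι : ∀ j → col v (ι j) ≡ col-at-v j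
  col-vι j = trans (cong-app (insertAt-lookup _ v _) (ι j)) (insertAt-punchIn col-at-v v left j)

  col-ιv : ∀ i → col (ι i) v ≡ col-at-v i
  col-ιv i = trans (cong-app (insertAt-punchIn _ v _ i) v) (insertAt-lookup (col′ i) v _)

  col-v-l : col v (ι l) ≡ left
  col-v-l with l ≟ l | col-vι l
  ... | yes _   | e = e
  ... | no  l≢l | _ = ⊥-elim (l≢l refl)

  col-v-r : col v (ι r) ≡ right
  col-v-r with r ≟ l | col-vι r
  ... | yes refl | _ = ⊥-elim (<-irrefl refl l<r)
  ... | no  _    | e = e

  ι-cancel-< : ∀ {i j} → pos (ι i) < pos (ι j) → pos′ i < pos′ j
  ι-cancel-< {i} {j} p = punchIn-cancel-< slot (subst₂ _<_ (pos-ι i) (pos-ι j) p)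

  ι<v⇒<slot : ∀ {i} → pos (ι i) < pos v → toℕ (pos′ i) ℕ.< toℕ slot
  ι<v⇒<slot {i} p = punchIn<⇒< slot (pos′ i) (subst₂ _<_ (pos-ι i) pos-v p)

  v<ι⇒slot≤ : ∀ {i} → pos v < pos (ι i) → toℕ slot ℕ.≤ toℕ (pos′ i)
  v<ι⇒slot≤ {i} p = <punchIn⇒≤ slot (pos′ i) (subst₂ _<_ pos-v (pos-ι i) p)

  l<v : pos (ι l) < pos v
  l<v = subst₂ _<_ (sym (pos-ι l)) (sym pos-v) (<⇒punchIn< slot (pos′ l) (l<slot placed))
    where
    l<slot : Placement slot → toℕ (pos′ l) ℕ.< toℕ slot
    l<slot (before-r _ slot≡r)  = subst (toℕ (pos′ l) ℕ.<_) (sym slot≡r) l<r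
    l<slot (after-l _ slot≡l+1) = ℕ.≤-reflexive (sym slot≡l+1)

  v<r : pos v < pos (ι r)
  v<r = subst₂ _<_ (sym pos-v) (sym (pos-ι r)) (≤⇒<punchIn slot (pos′ r) (slot≤r placed))
    where
    slot≤r : Placement slot → toℕ slot ℕ.≤ toℕ (pos′ r)
    slot≤r (before-r _ slot≡r)  = ℕ.≤-reflexive slot≡r
    slot≤r (after-l _ slot≡l+1) = subst (ℕ._≤ toℕ (pos′ r)) (sym slot≡l+1) l<r

  old-edge : ∀ {c i j} → AdjC G col c (ι i) (ι j) → AdjC (delete G v) col′ c i j
  old-edge {i = i} {j} (e , c) = e , trans (sym (col-ιι i j)) c

  v-nbr : ∀ {i} → Adj G v (ι i) → i ≡ l ⊎ i ≡ r
  v-nbr {i} e = ⊎-map (punchIn-injective v i l) (punchIn-injective v i r) (v-nbhd (ι i) e)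

  v-edge : ∀ {c i} → AdjC G col c v (ι i) → i ≡ l × c ≡ left ⊎ i ≡ r × c ≡ right
  v-edge (e , c) with v-nbr e
  ... | inj₁ refl = inj₁ (refl , trans (sym c) col-v-l)
  ... | inj₂ refl = inj₂ (refl , trans (sym c) col-v-r)

  pos-injective : Injective _≡_ _≡_ pos
  pos-injective {x} {y} e with punchInView v x | punchInView v y
  ... | ‵pivot     | ‵pivot     = refl
  ... | ‵pivot     | ‵punchIn j =
    ⊥-elim (punchInᵢ≢i slot (pos′ j) (trans (sym (pos-ι j)) (trans (sym e) pos-v)))
  ... | ‵punchIn i | ‵pivot     =
    ⊥-elim (punchInᵢ≢i slot (pos′ i) (trans (sym (pos-ι i)) (trans e pos-v)))
  ... | ‵punchIn i | ‵punchIn j =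
    cong ι (pos′-injective (punchIn-injective slot _ _ (trans (sym (pos-ι i)) (trans e (pos-ι j)))))

  col-sym : ∀ x y → Adj G x y → col x y ≡ col y x
  col-sym x y e with punchInView v x | punchInView v y
  ... | ‵pivot     | ‵pivot     = ⊥-elim (Adj-irrefl G v e)
  ... | ‵pivot     | ‵punchIn j = trans (col-vι j) (sym (col-ιv j))
  ... | ‵punchIn i | ‵pivot     = trans (col-ιv i) (sym (col-vι i))
  ... | ‵punchIn i | ‵punchIn j = trans (col-ιι i j) (trans (col′-sym i j e) (sym (col-ιι j i)))

  edge-sym : ∀ {c x y} → AdjC G col c x y → AdjC G col c y x
  edge-sym = AdjC-sym G col-sym

  v-left-edge : ∀ {w} → AdjC G col left v w → w ≡ ι l
  v-left-edge {w} e with punchInView v w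
  ... | ‵pivot = ⊥-elim (Adj-irrefl G v (proj₁ e))
  ... | ‵punchIn i with v-edge e
  ...   | inj₁ (refl , _) = refl
  ...   | inj₂ (_ , ())

  v-right-edge : ∀ {w} → AdjC G col right v w → w ≡ ι r
  v-right-edge {w} e with punchInView v w
  ... | ‵pivot = ⊥-elim (Adj-irrefl G v (proj₁ e))
  ... | ‵punchIn i with v-edge e
  ...   | inj₁ (_ , ())
  ...   | inj₂ (refl , _) = refl

  left-edge-at-v : ∀ {w} → AdjC G col left w v → pos w < pos v
  left-edge-at-v e = subst (λ u → pos u < pos v) (sym (v-left-edge (edge-sym e))) l<v

  right-edge-at-v : ∀ {w} → AdjC G col right w v → pos v < pos w
  right-edge-at-v e = subst (λ u → pos v < pos u) (sym (v-right-edge (edge-sym e))) v<r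

  v-nbr-not-between : ∀ {x} → Adj G v x → pos (ι l) < pos x → pos x < pos (ι r) → ⊥
  v-nbr-not-between {x} e l<x x<r with v-nbhd x e
  ... | inj₁ refl = <-irrefl refl l<x
  ... | inj₂ refl = <-irrefl refl x<r

  left-parent-unique : ∀ x y z → AdjC G col left x y → AdjC G col left x z →
                       pos y < pos x → pos z < pos x → y ≡ z
  left-parent-unique x y z xy xz y<x z<x with punchInView v x | punchInView v y | punchInView v z
  ... | ‵pivot     | _          | _           = trans (v-left-edge xy) (sym (v-left-edge xz))
  ... | ‵punchIn _ | ‵pivot     | _           = ⊥-elim (<-asym (left-edge-at-v xy) y<x)
  ... | ‵punchIn _ | ‵punchIn _ | ‵pivot      = ⊥-elim (<-asym (left-edge-at-v xz) z<x)
  ... | ‵punchIn i | ‵punchIn j | ‵punchIn j′ =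
    cong ι (left-parent-unique′ i j j′ (old-edge xy) (old-edge xz) (ι-cancel-< y<x) (ι-cancel-< z<x))

  right-parent-unique : ∀ x y z → AdjC G col right x y → AdjC G col right x z →
                        pos x < pos y → pos x < pos z → y ≡ z
  right-parent-unique x y z xy xz x<y x<z with punchInView v x | punchInView v y | punchInView v z
  ... | ‵pivot     | _          | _           = trans (v-right-edge xy) (sym (v-right-edge xz))
  ... | ‵punchIn _ | ‵pivot     | _           = ⊥-elim (<-asym (right-edge-at-v xy) x<y)
  ... | ‵punchIn _ | ‵punchIn _ | ‵pivot      = ⊥-elim (<-asym (right-edge-at-v xz) x<z)
  ... | ‵punchIn i | ‵punchIn j | ‵punchIn j′ =
    cong ι (right-parent-unique′ i j j′ (old-edge xy) (old-edge xz) (ι-cancel-< x<y) (ι-cancel-< x<z))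

  under-left-arc : ∀ a b x → AdjC G col left a b → pos a < pos b →
                   Adj G x b → pos a < pos x → pos x < pos b → col x b ≡ right
  under-left-arc a b x ab a<b xb a<x x<b with punchInView v a | punchInView v b | punchInView v x
  ... | ‵pivot     | _          | _          = ⊥-elim (<-asym (left-edge-at-v (edge-sym ab)) a<b)
  ... | ‵punchIn _ | ‵pivot     | _          =
    ⊥-elim (v-nbr-not-between (Adj-sym G xb) l<x (<-trans x<b v<r))
    where
    l<x : pos (ι l) < pos x
    l<x = subst (λ u → pos u < pos x) (v-left-edge (edge-sym ab)) a<x
  ... | ‵punchIn _ | ‵punchIn j | ‵pivot     with v-nbr xb
  ...   | inj₁ refl = ⊥-elim (<-asym l<v x<b)
  ...   | inj₂ refl = col-v-r
  under-left-arc a b x ab a<b xb a<x x<b | ‵punchIn i | ‵punchIn j | ‵punchIn k =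
    trans (col-ιι k j)
      (under-left-arc′ i j k (old-edge ab) (ι-cancel-< a<b) xb (ι-cancel-< a<x) (ι-cancel-< x<b))

  under-right-arc : ∀ a b x → AdjC G col right a b → pos a < pos b →
                    Adj G a x → pos a < pos x → pos x < pos b → col a x ≡ left
  under-right-arc a b x ab a<b ax a<x x<b with punchInView v a | punchInView v b | punchInView v x
  ... | ‵pivot     | _          | _          =
    ⊥-elim (v-nbr-not-between ax (<-trans l<v a<x) x<r)
    where
    x<r : pos x < pos (ι r)
    x<r = subst (λ u → pos x < pos u) (v-right-edge ab) x<b
  ... | ‵punchIn _ | ‵pivot     | _          = ⊥-elim (<-asym (right-edge-at-v ab) a<b)
  ... | ‵punchIn i | ‵punchIn _ | ‵pivot     with v-nbr (Adj-sym G ax)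
  ...   | inj₁ refl = trans (col-sym _ _ ax) col-v-l
  ...   | inj₂ refl = ⊥-elim (<-asym v<r a<x)
  under-right-arc a b x ab a<b ax a<x x<b | ‵punchIn i | ‵punchIn j | ‵punchIn k =
    trans (col-ιι i k)
      (under-right-arc′ i j k (old-edge ab) (ι-cancel-< a<b) ax (ι-cancel-< a<x) (ι-cancel-< x<b))

  v-left-edge-uncrossed : ∀ {x y} → AdjC G col left (ι x) (ι y) →
                          pos (ι l) < pos (ι x) → pos (ι x) < pos v →
                          pos (ι y) < pos (ι l) ⊎ pos v < pos (ι y) → ⊥
  v-left-edge-uncrossed {x} {y} xy l<x x<v y-outside with placed
  ... | after-l _ slot≡l+1 =
    ℕ.<⇒≱ (ι-cancel-< l<x) (ℕ.s≤s⁻¹ (subst (toℕ (pos′ x) ℕ.<_) slot≡l+1 (ι<v⇒<slot x<v)))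
  ... | before-r lr-left slot≡r =
    left-arc-shields (l-r , lr-left) l<r (ι-cancel-< l<x)
      (subst (toℕ (pos′ x) ℕ.<_) slot≡r (ι<v⇒<slot x<v)) (old-edge xy)
      (⊎-map ι-cancel-< (subst (ℕ._≤ toℕ (pos′ y)) slot≡r ∘ v<ι⇒slot≤) y-outside)

  v-right-edge-uncrossed : ∀ {x y} → AdjC G col right (ι x) (ι y) →
                           pos v < pos (ι x) → pos (ι x) < pos (ι r) →
                           pos (ι y) < pos v ⊎ pos (ι r) < pos (ι y) → ⊥
  v-right-edge-uncrossed {x} {y} xy v<x x<r y-outside with placed
  ... | before-r _ slot≡r =
    ℕ.<⇒≱ (ι-cancel-< x<r) (subst (ℕ._≤ toℕ (pos′ x)) slot≡r (v<ι⇒slot≤ v<x))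
  ... | after-l lr-right slot≡l+1 =
    right-arc-shields (l-r , lr-right) l<r
      (subst (ℕ._≤ toℕ (pos′ x)) slot≡l+1 (v<ι⇒slot≤ v<x)) (ι-cancel-< x<r) (old-edge xy)
      (⊎-map (ℕ.s≤s⁻¹ ∘ subst (toℕ (pos′ y) ℕ.<_) slot≡l+1 ∘ ι<v⇒<slot) ι-cancel-< y-outside)

  nonCrossing : ∀ c → ClassNonCrossing G pos col c
  nonCrossing c a b x y ab xy (a<x , x<b , b<y)
    with punchInView v a | punchInView v b | punchInView v x | punchInView v y
  ... | ‵pivot | ‵pivot | _      | _      = Adj-irrefl G v (proj₁ ab)
  ... | _      | _      | ‵pivot | ‵pivot = Adj-irrefl G v (proj₁ xy)
  ... | ‵pivot | _      | ‵pivot | _      = <-irrefl refl a<x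
  ... | ‵pivot | _      | _      | ‵pivot = <-asym a<x (<-trans x<b b<y)
  ... | _      | ‵pivot | ‵pivot | _      = <-irrefl refl x<b
  ... | _      | ‵pivot | _      | ‵pivot = <-irrefl refl b<y
  ... | ‵pivot | ‵punchIn _ | ‵punchIn _ | ‵punchIn _ with v-edge ab
  ...   | inj₁ (refl , refl) = <-asym l<v (<-trans a<x x<b)
  ...   | inj₂ (refl , refl) = v-right-edge-uncrossed xy a<x x<b (inj₂ b<y)
  nonCrossing c a b x y ab xy (a<x , x<b , b<y) | ‵punchIn _ | ‵pivot | ‵punchIn _ | ‵punchIn _
    with v-edge (edge-sym ab)
  ...   | inj₁ (refl , refl) = v-left-edge-uncrossed xy a<x x<b (inj₂ b<y)
  ...   | inj₂ (refl , refl) = <-asym v<r (<-trans a<x x<b)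
  nonCrossing c a b x y ab xy (a<x , x<b , b<y) | ‵punchIn _ | ‵punchIn _ | ‵pivot | ‵punchIn _
    with v-edge xy
  ...   | inj₁ (refl , refl) = <-asym l<v (<-trans x<b b<y)
  ...   | inj₂ (refl , refl) = v-right-edge-uncrossed (edge-sym ab) x<b b<y (inj₁ a<x)
  nonCrossing c a b x y ab xy (a<x , x<b , b<y) | ‵punchIn _ | ‵punchIn _ | ‵punchIn _ | ‵pivot
    with v-edge (edge-sym xy)
  ...   | inj₁ (refl , refl) = v-left-edge-uncrossed (edge-sym ab) x<b b<y (inj₁ a<x)
  ...   | inj₂ (refl , refl) = <-asym v<r (<-trans x<b b<y)
  nonCrossing c a b x y ab xy (a<x , x<b , b<y) | ‵punchIn i | ‵punchIn j | ‵punchIn k | ‵punchIn m =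
    nonCrossing′ c i j k m (old-edge ab) (old-edge xy)
      (ι-cancel-< a<x , ι-cancel-< x<b , ι-cancel-< b<y)

  layout : Layout G
  layout = record
    { pos = pos ; col = col ; pos-injective = pos-injective ; col-sym = col-sym
    ; nonCrossing = nonCrossing
    ; left-parent-unique = left-parent-unique ; right-parent-unique = right-parent-unique
    ; under-left-arc = under-left-arc ; under-right-arc = under-right-arc
    }

  v-colourful : Colourful G col v
  v-colourful = colourful-of-two-neighbours {G = G} {col} v-nbhd
    (λ e → left≢right (trans (sym col-v-l) (trans e col-v-r)))

  attached-¬twoSimplicial : ∀ {i} → Adj G v (ι i) → TwoNeighbours (delete G v) i →
                            ¬ TwoSimplicial G (ι i)
  attached-¬twoSimplicial v~i (y , z , y≢z , iy , iz) =
    three-neighbours⇒¬twoSimplicial G (punchInᵢ≢i v y ∘ sym) (punchInᵢ≢i v z ∘ sym)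
      (y≢z ∘ punchIn-injective v y z) (Adj-sym G v~i) iy iz

  all-colourful : Adj G v (ι l) → Adj G v (ι r) → (∀ i → TwoNeighbours (delete G v) i) →
    ∀ {z} → z ≡ l ⊎ z ≡ r → ColourfulExcept (delete G v) col′ z → AllColourful G col
  all-colourful v~l v~r two-neighbours {z} z∈lr colourful′ w w-simplicial with punchInView v w
  ... | ‵pivot     = v-colourful
  ... | ‵punchIn i with Adj? G v (ι i)
  ...   | yes v~i = ⊥-elim (attached-¬twoSimplicial v~i (two-neighbours i) w-simplicial)
  ...   | no  v≁i = colourful-lift G v v≁i {col} {col′} (col-ιι i)
                      (colourful′ i (v≁i ∘ v~ι) (twoSimplicial-delete G v v≁i w-simplicial))
    where
    v~ι : i ≡ z → Adj G v (ι i)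
    v~ι refl = [ (λ { refl → v~l }) , (λ { refl → v~r }) ]′ z∈lr

twoTree-twoNeighbours : ∀ {n} {G : Graph n} → IsTwoTree G → ∀ x → TwoNeighbours G x
twoTree-twoNeighbours (triangle G complete) x =
  punchIn x zero , punchIn x (suc zero) , (λ ()) ∘ punchIn-injective x zero (suc zero) ,
  complete x _ (punchInᵢ≢i x zero ∘ sym) , complete x _ (punchInᵢ≢i x (suc zero) ∘ sym)
twoTree-twoNeighbours (extend G v (a , b , a≢b , v~a , v~b , _) two-tree) x with punchInView v x
... | ‵pivot     = a , b , a≢b , v~a , v~b
... | ‵punchIn i with twoTree-twoNeighbours two-tree i
...   | y , z , y≢z , i~y , i~z = punchIn v y , punchIn v z , y≢z ∘ punchIn-injective v y z , i~y , i~z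

twoTree-size : ∀ {n} {G : Graph n} → IsTwoTree G → 3 ℕ.≤ n
twoTree-size (triangle _ _)   = ℕ.≤-refl
twoTree-size (extend _ _ _ t) = ℕ.m≤n⇒m≤1+n (twoTree-size t)

complete≅K3 : (G : Graph 3) → IsComplete G → G ≅ K3
complete≅K3 G complete = ↔-id _ , same-adj
  where
  same-adj : ∀ i j → adj G i j ≡ adj K3 i j
  same-adj i j with i ≟ j
  ... | yes refl = irrefl G i
  ... | no  i≢j  = complete i j i≢j

Fin2-cover : ∀ (l j : Fin 2) → j ≡ l ⊎ j ≡ punchIn l zero
Fin2-cover l j with punchInView l j
... | ‵pivot        = inj₁ refl
... | ‵punchIn zero = inj₂ refl

Fin2-≢-unique : ∀ {x y z : Fin 2} → x ≢ y → x ≢ z → y ≡ z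
Fin2-≢-unique {x} {y} {z} x≢y x≢z with Fin2-cover x y | Fin2-cover x z
... | inj₁ y≡x | _        = ⊥-elim (x≢y (sym y≡x))
... | inj₂ _   | inj₁ z≡x = ⊥-elim (x≢z (sym z≡x))
... | inj₂ y≡o | inj₂ z≡o = trans y≡o (sym z≡o)

Fin2-¬<-chain : ∀ {a b c : Fin 2} → a < b → b < c → ⊥
Fin2-¬<-chain {c = c} a<b b<c =
  ℕ.<⇒≱ (toℕ<n c) (ℕ.≤-trans (s≤s (ℕ.≤-trans (s≤s z≤n) a<b)) b<c)

edge-layout : (H : Graph 2) (pos : Fin 2 → Fin 2) → Injective _≡_ _≡_ pos → Layout H
edge-layout H pos pos-injective = record
  { pos = pos ; col = λ _ _ → left ; pos-injective = pos-injective ; col-sym = λ _ _ _ → refl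
  ; nonCrossing = λ _ _ _ _ _ _ _ (a<x , x<b , _) → Fin2-¬<-chain a<x x<b
  ; left-parent-unique  = λ _ _ _ xy xz _ _ → Fin2-≢-unique (Adj⇒≢ H (proj₁ xy)) (Adj⇒≢ H (proj₁ xz))
  ; right-parent-unique = λ _ _ _ xy xz _ _ → Fin2-≢-unique (Adj⇒≢ H (proj₁ xy)) (Adj⇒≢ H (proj₁ xz))
  ; under-left-arc  = λ _ _ _ _ _ _ l<x x<r → ⊥-elim (Fin2-¬<-chain l<x x<r)
  ; under-right-arc = λ _ _ _ _ _ _ l<x x<r → ⊥-elim (Fin2-¬<-chain l<x x<r)
  }

front : Fin 2 → Fin 2 → Fin 2
front zero       j = j
front (suc zero) j = opposite j

front-injective : ∀ l → Injective _≡_ _≡_ (front l)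
front-injective zero       e = e
front-injective (suc zero) {x} {y} e =
  trans (sym (opposite-involutive x)) (trans (cong opposite e) (opposite-involutive y))

front-first : ∀ l → front l l < front l (punchIn l zero)
front-first zero       = ℕ.z<s
front-first (suc zero) = ℕ.z<s

triangle-layout : (G : Graph 3) → IsComplete G → ∀ z →
  ∃ λ (L : Layout G) → ∀ w → w ≢ z → Colourful G (Layout.col L) w
triangle-layout G complete z = layout , colourful
  where
  w : Fin 3
  w = punchIn z zero

  w≢z : w ≢ z
  w≢z = punchInᵢ≢i z zero

  -- w is attached last, to the edge lr with ι l = z; l then has two left edges.
  l r : Fin 2
  l = punchOut w≢z
  r = punchIn l zero

  l-r : Adj (delete G w) l r
  l-r = complete _ _ (punchInᵢ≢i l zero ∘ sym ∘ punchIn-injective w l r)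

  w-nbhd : ∀ u → Adj G w u → u ≡ punchIn w l ⊎ u ≡ punchIn w r
  w-nbhd u w~u with punchInView w u
  ... | ‵pivot     = ⊥-elim (Adj-irrefl G w w~u)
  ... | ‵punchIn j = ⊎-map (cong (punchIn w)) (cong (punchIn w)) (Fin2-cover l j)

  open Extension G w (edge-layout (delete G w) (front l) (front-injective l)) l r l-r (front-first l)
                 w-nbhd

  r-nbhd : ∀ u → Adj G (ι r) u → u ≡ ι l ⊎ u ≡ w
  r-nbhd u r~u with punchInView w u
  ... | ‵pivot     = inj₂ refl
  ... | ‵punchIn j with Fin2-cover l j
  ...   | inj₁ refl = inj₁ refl
  ...   | inj₂ refl = ⊥-elim (Adj-irrefl G _ r~u)

  col-r-w : col (ι r) w ≡ right
  col-r-w = trans (col-sym _ _ (complete _ _ (punchInᵢ≢i w r))) col-v-r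

  colourful : ∀ u → u ≢ z → Colourful G col u
  colourful u u≢z with punchInView w u
  ... | ‵pivot     = v-colourful
  ... | ‵punchIn j with Fin2-cover l j
  ...   | inj₁ refl = ⊥-elim (u≢z (punchIn-punchOut w≢z))
  ...   | inj₂ refl = colourful-of-two-neighbours {G = G} {col} r-nbhd
                        (λ e → left≢right (trans (sym (col-ιι r l)) (trans e col-r-w)))

extend-layout : ∀ {n} (G : Graph (suc n)) (v : Fin (suc n)) →
  TwoSimplicial G v → IsTwoTree (delete G v) →
  (∀ z → ∃ λ (L : Layout (delete G v)) → ColourfulExcept (delete G v) (Layout.col L) z) →
  ∃ λ (L : Layout G) → AllColourful G (Layout.col L)
extend-layout G v (a , b , a≢b , v~a , v~b , a~b , nbhd) two-tree layouts
  with punchInView v a | punchInView v b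
... | ‵pivot      | _           = ⊥-elim (Adj-irrefl G v v~a)
... | ‵punchIn _  | ‵pivot      = ⊥-elim (Adj-irrefl G v v~b)
... | ‵punchIn a′ | ‵punchIn b′ with layouts a′
...   | L′ , colourful′ with <-cmp (Layout.pos L′ a′) (Layout.pos L′ b′)
...     | tri< a<b _ _ =
  let open Extension G v L′ a′ b′ a~b a<b nbhd
  in layout , all-colourful v~a v~b (twoTree-twoNeighbours two-tree) (inj₁ refl) colourful′
...     | tri≈ _ a≡b _ = ⊥-elim (a≢b (cong (punchIn v) (Layout.pos-injective L′ a≡b)))
...     | tri> _ _ b<a =
  let open Extension G v L′ b′ a′ (Adj-sym G a~b) b<a (λ u → ⊎-swap ∘ nbhd u)
  in layout , all-colourful v~b v~a (twoTree-twoNeighbours two-tree) (inj₂ refl) colourful′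

twoTree-layout : ∀ {n} {G : Graph n} → IsTwoTree G →
  ∀ z → ∃ λ (L : Layout G) → ColourfulExcept G (Layout.col L) z
twoTree-layout (triangle G complete) z with triangle-layout G complete z
... | L , colourful = L , λ w w≢z _ → colourful w w≢z
twoTree-layout (extend G v simplicial two-tree) _
  with extend-layout G v simplicial two-tree (twoTree-layout two-tree)
... | L , colourful = L , λ w _ → colourful w

lemma3 : ∀ {n} (G : Graph n) → IsTwoTree G →
    Σ (Fin n → Fin n) λ pos → Injective _≡_ _≡_ pos ×
    Σ (Colouring n) λ col →
      (∀ i j → Adj G i j → col i j ≡ col j i) ×
      (∀ c → ClassForest G col c) ×
      (∀ c → ClassNonCrossing G pos col c) ×
      (G ≅ K3 → Σ (Fin n) λ u → Σ (Fin n) λ v →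
          u ≢ v × Colourful G col u × Colourful G col v) ×
      (¬ (G ≅ K3) → ∀ v → TwoSimplicial G v → Colourful G col v)
lemma3 _ (triangle G complete) with triangle-layout G complete zero
... | L , colourful =
  pos , pos-injective , col , col-sym , forest , nonCrossing ,
  (λ _ → suc zero , suc (suc zero) , (λ ()) , colourful _ (λ ()) , colourful _ (λ ())) ,
  (λ G≇K3 → ⊥-elim (G≇K3 (complete≅K3 G complete)))
  where open Layout L
        open LayoutProperties L using (forest)
lemma3 _ (extend G v simplicial two-tree)
  with extend-layout G v simplicial two-tree (twoTree-layout two-tree)
... | L , colourful =
  pos , pos-injective , col , col-sym , forest , nonCrossing ,
  (λ G≅K3 → ⊥-elim (ℕ.<-irrefl (sym (ℕ.suc-injective (↔⇒≡ (proj₁ G≅K3))))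
                                (twoTree-size two-tree))) ,
  (λ _ → colourful)
  where open Layout L
        open LayoutProperties L using (forest)
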